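{- Let $\Delta$ be an imaginary quadratic discriminant, $p$ an odd prime and $k$ a positive integer with $p^{2k+1}\mid\Delta$. Write $\Delta=-p^{2k}m$, and set $\delta=2$ if $\Delta$ is odd and $\delta=1$ if $\Delta$ is even. If $m\ge \frac49 p^{2k}$, then $\min\{p^{2k},\,(m+(p^k-\delta)^2)/4\}$ is suitable for $\Delta$.
   Context: An imaginary quadratic discriminant is an integer $\Delta<0$ with $\Delta\equiv 0,1\pmod 4$. $T_\Delta$ denotes the set of integer triples $(a,b,c)$ with $\gcd(a,b,c)=1$, $b^2-4ac=\Delta$, and either $-a<b\le a<c$ or $0\le b\le a=c$. A positive integer $a$ is suitable for $\Delta$ if there exist $b,c\in\mathbb{Z}$ with $(a,b,c)\in T_\Delta$. -}

module Defs where

open import Data.Nat as ℕ using (ℕ; zero; suc)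
open import Data.Integer as ℤ using (ℤ; +_; _-_; _*_; _<_; _≤_)
open import Data.Integer.GCD using (gcd)
open import Data.Integer.DivMod using (_%ℕ_)
open import Data.Integer.Divisibility using (_∣_)
open import Data.Nat.DivMod as ND using (_%_)
open import Data.Product using (_×_; ∃₂)
open import Data.Sum using (_⊎_)
open import Relation.Binary.PropositionalEquality using (_≡_)

ImagQuadDisc : ℤ → Set
ImagQuadDisc Δ = (Δ < + 0) × ((Δ %ℕ 4 ≡ 0) ⊎ (Δ %ℕ 4 ≡ 1))

InT : ℤ → ℤ → ℤ → ℤ → Set
InT Δ a b c =
  (gcd (gcd a b) c ≡ + 1) ×
  (b * b - (+ 4) * a * c ≡ Δ) ×
  ((ℤ.- a < b × b ≤ a × a < c) ⊎ (+ 0 ≤ b × b ≤ a × a ≡ c))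

Suitable : ℤ → ℕ → Set
Suitable Δ a = (0 ℕ.< a) × ∃₂ λ b c → InT Δ (+ a) b c

deltaOf : ℤ → ℕ
deltaOf Δ with Δ %ℕ 2
... | zero = 1
... | suc _ = 2

{-# OPTIONS --safe #-}
module Submission where

-- With x = p^k, δ as in the statement, q = x − δ and c = (m + q²)/4, the form (x², xq, c) has
-- discriminant −x²m = Δ (c is integral: Δ ≡ 0, 1 mod 4 forces m ≡ 0, 3 mod 4, and δ makes
-- q ≡ m mod 2), and it is primitive because p ∤ c (otherwise p ∣ q, hence p ∣ δ ∈ {1, 2}).
-- If x² ≤ c it is reduced. Otherwise one reduction step gives a reduced form with first
-- coefficient c: either the swap (c, xq, x²), or, when xq > c, the form (c, |xq − 2c|, x² − xq + c),
-- which is reduced because 4x² ≤ 9m forces xq ≤ 3c.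

open import Defs
open import Data.Nat using (ℕ; zero; suc; _+_; _*_; _∸_; _^_; _≤_; _<_; _⊓_; _/_; _%_; z≤n; s≤s; _≤?_; NonZero; nonTrivial⇒n>1)
open import Data.Nat.Properties
open import Data.Nat.DivMod using (m*[n/m]≡n; [m+kn]%n≡m%n; %-distribˡ-+; %-distribˡ-*; m%n%n≡m%n; m∣n⇒o%n%m≡o%m; m%n<n)
open import Data.Nat.Divisibility
open import Data.Nat.GCD using (gcd; gcd[m,n]∣m; gcd[m,n]∣n)
open import Data.Nat.Coprimality as Coprimality using (Coprime; coprime-divisor)
open import Data.Nat.Primality using (Prime; euclidsLemma; prime⇒irreducible; prime⇒nonZero; prime⇒nonTrivial)
open import Data.Nat.Tactic.RingSolver using (solve; solve-∀)
open import Data.Integer as ℤ using (ℤ; +_; -_; ∣_∣; +≤+; +<+; -<+)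
import Data.Integer.Properties as ℤP
import Data.Integer.Tactic.RingSolver as ℤSolver
open import Data.List using (_∷_; [])
open import Data.Product using (_×_; _,_; ∃-syntax)
open import Data.Sum using (_⊎_; inj₁; inj₂; [_,_]′)
open import Data.Empty using (⊥-elim)
open import Function using (id)
open import Relation.Nullary using (¬_; yes; no)
open import Relation.Binary.PropositionalEquality

coprime-*ʳ : ∀ {m n o} → Coprime m n → Coprime m o → Coprime m (n * o)
coprime-*ʳ m⊥n m⊥o (d∣m , d∣n*o) =
  m⊥o (d∣m , coprime-divisor (λ (e∣d , e∣n) → m⊥n (∣-trans e∣d d∣m , e∣n)) d∣n*o)

coprime-^ʳ : ∀ {m n} → Coprime m n → ∀ k → Coprime m (n ^ k)
coprime-^ʳ _   zero    = Coprimality.sym (Coprimality.1-coprimeTo _)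
coprime-^ʳ m⊥n (suc k) = coprime-*ʳ m⊥n (coprime-^ʳ m⊥n k)

∤-prime⇒coprime : ∀ {p n} → Prime p → ¬ p ∣ n → Coprime n p
∤-prime⇒coprime p-prime p∤n (d∣n , d∣p) with prime⇒irreducible p-prime d∣p
... | inj₁ d≡1  = d≡1
... | inj₂ refl = ⊥-elim (p∤n d∣n)

m^[n+1]∣m^n*o⇒m∣o : ∀ m n o .{{_ : NonZero m}} → m ^ (n + 1) ∣ m ^ n * o → m ∣ o
m^[n+1]∣m^n*o⇒m∣o m n o m^[n+1]∣m^n*o = *-cancelˡ-∣ (m ^ n) {{m^n≢0 m n}}
  (subst (_∣ m ^ n * o) (trans (^-distribˡ-+-* m n 1) (cong (m ^ n *_) (*-identityʳ m))) m^[n+1]∣m^n*o)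

m^n*m^n≡m^[2*n] : ∀ m n → m ^ n * m ^ n ≡ m ^ (2 * n)
m^n*m^n≡m^[2*n] m n = trans (sym (^-distribˡ-+-* m n n)) (cong (λ o → m ^ (n + o)) (sym (+-identityʳ n)))

1<n∧n%2≡1⇒2<n : ∀ {n} → 1 < n → n % 2 ≡ 1 → 2 < n
1<n∧n%2≡1⇒2<n {1} (s≤s ()) _
1<n∧n%2≡1⇒2<n {2} _ ()
1<n∧n%2≡1⇒2<n {suc (suc (suc _))} _ _ = s≤s (s≤s (s≤s z≤n))

m%2≡1⇒m^n%2≡1 : ∀ m n → m % 2 ≡ 1 → m ^ n % 2 ≡ 1
m%2≡1⇒m^n%2≡1 m zero    _     = refl
m%2≡1⇒m^n%2≡1 m (suc n) m%2≡1 = trans (%-distribˡ-* m (m ^ n) 2)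
  (cong₂ (λ r s → r * s % 2) m%2≡1 (m%2≡1⇒m^n%2≡1 m n m%2≡1))

m%d≡1⇒m*n%d≡n%d : ∀ {d} .{{_ : NonZero d}} m n → m % d ≡ 1 → m * n % d ≡ n % d
m%d≡1⇒m*n%d≡n%d {d} m n m%d≡1 = begin
  m * n % d                 ≡⟨ %-distribˡ-* m n d ⟩
  (m % d) * (n % d) % d     ≡⟨ cong (λ r → r * (n % d) % d) m%d≡1 ⟩
  1 * (n % d) % d           ≡⟨ cong (_% d) (*-identityˡ (n % d)) ⟩
  n % d % d                 ≡⟨ m%n%n≡m%n n d ⟩
  n % d                     ∎
  where open ≡-Reasoning

n*n%4≡n%2 : ∀ n → n * n % 4 ≡ n % 2
n*n%4≡n%2 0 = refl
n*n%4≡n%2 1 = refl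
n*n%4≡n%2 (suc (suc n)) = begin
  (2 + n) * (2 + n) % 4      ≡⟨ cong (_% 4) (square n) ⟩
  (n * n + (1 + n) * 4) % 4  ≡⟨ [m+kn]%n≡m%n (n * n) (1 + n) 4 ⟩
  n * n % 4                  ≡⟨ n*n%4≡n%2 n ⟩
  n % 2                      ∎
  where
  open ≡-Reasoning
  square : ∀ n → (2 + n) * (2 + n) ≡ n * n + (1 + n) * 4
  square = solve-∀

[m+n]%2≡1⇒m%2≡[1+n]%2 : ∀ m n → (m + n) % 2 ≡ 1 → m % 2 ≡ (1 + n) % 2
[m+n]%2≡1⇒m%2≡[1+n]%2 m n [m+n]%2≡1 = begin
  m % 2                      ≡⟨ sym ([m+kn]%n≡m%n m n 2) ⟩
  (m + n * 2) % 2            ≡⟨ cong (_% 2) (regroup m n) ⟩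
  (m + n + n) % 2            ≡⟨ %-distribˡ-+ (m + n) n 2 ⟩
  ((m + n) % 2 + n % 2) % 2  ≡⟨ cong (λ r → (r + n % 2) % 2) [m+n]%2≡1 ⟩
  (1 + n % 2) % 2            ≡⟨ sym (%-distribˡ-+ 1 n 2) ⟩
  (1 + n) % 2                ∎
  where
  open ≡-Reasoning
  regroup : ∀ m n → m + n * 2 ≡ m + n + n
  regroup = solve-∀

2*m*n≤m*m+n*n : ∀ m n → 2 * m * n ≤ m * m + n * n
2*m*n≤m*m+n*n m n = [ ordered , swapped ]′ (≤-total m n)
  where
  open ≤-Reasoning
  ordered : ∀ {m n} → m ≤ n → 2 * m * n ≤ m * m + n * n
  ordered {m} m≤n with t , refl ← m≤n⇒∃[o]m+o≡n m≤n = begin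
    2 * m * (m + t)            ≤⟨ m≤m+n (2 * m * (m + t)) (t * t) ⟩
    2 * m * (m + t) + t * t    ≡⟨ solve (m ∷ t ∷ []) ⟩
    m * m + (m + t) * (m + t)  ∎
  swapped : n ≤ m → 2 * m * n ≤ m * m + n * n
  swapped n≤m = begin
    2 * m * n      ≡⟨ solve (m ∷ n ∷ []) ⟩
    2 * n * m      ≤⟨ ordered n≤m ⟩
    n * n + m * m  ≡⟨ +-comm (n * n) (m * m) ⟩
    m * m + n * n  ∎

imagQuadDisc⇒%4 : ∀ n → ImagQuadDisc (- (+ n)) → n % 4 ≡ 0 ⊎ n % 4 ≡ 3
imagQuadDisc⇒%4 zero    _         = inj₁ refl
imagQuadDisc⇒%4 (suc n) (_ , Δ%4) with suc n % 4 | m%n<n (suc n) 4 | Δ%4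
... | 0 | _ | _      = inj₁ refl
... | 1 | _ | inj₁ ()
... | 1 | _ | inj₂ ()
... | 2 | _ | inj₁ ()
... | 2 | _ | inj₂ ()
... | 3 | _ | _      = inj₂ refl
... | suc (suc (suc (suc _))) | s≤s (s≤s (s≤s (s≤s ()))) | _

deltaOf-neg : ∀ n → deltaOf (- (+ n)) ≡ 1 + n % 2
deltaOf-neg zero = refl
deltaOf-neg (suc n) with suc n % 2 | m%n<n (suc n) 2
... | 0 | _ = refl
... | 1 | _ = refl
... | suc (suc _) | s≤s (s≤s ())

inT : ∀ {N A B C} → 0 < A → B ≤ A → A ≤ C → B * B + N ≡ 4 * A * C →
      (∀ {d} → d ∣ A → d ∣ B → d ∣ C → d ≡ 1) → InT (- (+ N)) (+ A) (+ B) (+ C)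
inT {N} {A@(suc _)} {B} {C} _ B≤A A≤C disc coprime₃ =
  cong +_ gcd≡1 , disc-ℤ , order (m≤n⇒m<n∨m≡n A≤C)
  where
  gcd≡1 : gcd (gcd A B) C ≡ 1
  gcd≡1 = coprime₃ (∣-trans (gcd[m,n]∣m (gcd A B) C) (gcd[m,n]∣m A B))
                    (∣-trans (gcd[m,n]∣m (gcd A B) C) (gcd[m,n]∣n A B)) (gcd[m,n]∣n (gcd A B) C)
  disc-ℤ : + B ℤ.* + B ℤ.- + 4 ℤ.* + A ℤ.* + C ≡ - (+ N)
  disc-ℤ = begin
    + B ℤ.* + B ℤ.- + 4 ℤ.* + A ℤ.* + C    ≡⟨ cong₂ ℤ._-_ (sym (ℤP.pos-* B B))
                                                (trans (cong (ℤ._* + C) (sym (ℤP.pos-* 4 A))) (sym (ℤP.pos-* (4 * A) C))) ⟩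
    + (B * B) ℤ.- + (4 * A * C)            ≡⟨ cong (λ n → + (B * B) ℤ.- + n) (sym disc) ⟩
    + (B * B) ℤ.- + (B * B + N)            ≡⟨ cong (λ n → + (B * B) ℤ.- n) (ℤP.pos-+ (B * B) N) ⟩
    + (B * B) ℤ.- (+ (B * B) ℤ.+ + N)      ≡⟨ cancel (+ (B * B)) (+ N) ⟩
    - (+ N)                                 ∎
    where
    open ≡-Reasoning
    cancel : ∀ i j → i ℤ.- (i ℤ.+ j) ≡ - j
    cancel = ℤSolver.solve-∀
  order : A < C ⊎ A ≡ C → ((- (+ A) ℤ.< + B) × (+ B ℤ.≤ + A) × (+ A ℤ.< + C)) ⊎
                          ((+ 0 ℤ.≤ + B) × (+ B ℤ.≤ + A) × (+ A ≡ + C))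
  order (inj₁ A<C) = inj₁ (-<+ , +≤+ B≤A , +<+ A<C)
  order (inj₂ A≡C) = inj₂ (+≤+ z≤n , +≤+ B≤A , cong +_ A≡C)

∣b-2c∣≤c : ∀ {b c} → c ≤ b → b ≤ 3 * c → ∃[ t ] t ≤ c × (b + t ≡ 2 * c ⊎ 2 * c + t ≡ b)
∣b-2c∣≤c {b} {c} c≤b b≤3c with ≤-total b (2 * c)
... | inj₁ b≤2c with t , b+t≡2c ← m≤n⇒∃[o]m+o≡n b≤2c = t , +-cancelˡ-≤ b t c b+t≤b+c , inj₁ b+t≡2c
  where
  open ≤-Reasoning
  b+t≤b+c : b + t ≤ b + c
  b+t≤b+c = begin
    b + t  ≡⟨ b+t≡2c ⟩
    2 * c  ≡⟨ solve (c ∷ []) ⟩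
    c + c  ≤⟨ +-monoˡ-≤ c c≤b ⟩
    b + c  ∎
... | inj₂ 2c≤b with t , 2c+t≡b ← m≤n⇒∃[o]m+o≡n 2c≤b = t , +-cancelˡ-≤ (2 * c) t c 2c+t≤2c+c , inj₂ 2c+t≡b
  where
  open ≤-Reasoning
  2c+t≤2c+c : 2 * c + t ≤ 2 * c + c
  2c+t≤2c+c = begin
    2 * c + t  ≡⟨ 2c+t≡b ⟩
    b          ≤⟨ b≤3c ⟩
    3 * c      ≡⟨ solve (c ∷ []) ⟩
    2 * c + c  ∎

reflect-square : ∀ {b s t} → b + t ≡ s ⊎ s + t ≡ b → t * t + 2 * b * s ≡ b * b + s * s
reflect-square {b} {t = t} (inj₁ refl) = solve (b ∷ t ∷ [])
reflect-square {s = s} {t} (inj₂ refl) = solve (s ∷ t ∷ [])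

reduced-disc : ∀ {N X b e c t} → X ≡ b + e → b * b + N ≡ 4 * X * c →
               b + t ≡ 2 * c ⊎ 2 * c + t ≡ b → t * t + N ≡ 4 * c * (c + e)
reduced-disc {N} {b = b} {e} {c} {t} refl disc reflection = +-cancelʳ-≡ (4 * b * c) _ _ (begin
  t * t + N + 4 * b * c          ≡⟨ solve (t ∷ N ∷ b ∷ c ∷ []) ⟩
  t * t + 2 * b * (2 * c) + N    ≡⟨ cong (_+ N) (reflect-square reflection) ⟩
  b * b + 2 * c * (2 * c) + N    ≡⟨ solve (b ∷ c ∷ N ∷ []) ⟩
  b * b + N + 4 * c * c          ≡⟨ cong (_+ 4 * c * c) disc ⟩
  4 * (b + e) * c + 4 * c * c    ≡⟨ solve (b ∷ e ∷ c ∷ []) ⟩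
  4 * c * (c + e) + 4 * b * c    ∎)
  where open ≡-Reasoning

inT-reduced : ∀ {N X b e c t} → 0 < c → t ≤ c → X ≡ b + e → b * b + N ≡ 4 * X * c → Coprime c X →
              b + t ≡ 2 * c ⊎ 2 * c + t ≡ b → InT (- (+ N)) (+ c) (+ t) (+ (c + e))
inT-reduced {b = b} {e} {c} {t} 0<c t≤c X≡b+e disc c⊥X reflection =
  inT 0<c t≤c (m≤m+n c e) (reduced-disc X≡b+e disc reflection) coprime₃
  where
  coprime₃ : ∀ {d} → d ∣ c → d ∣ t → d ∣ c + e → d ≡ 1
  coprime₃ {d} d∣c d∣t d∣c+e = c⊥X (d∣c , subst (d ∣_) (sym X≡b+e) (∣m∣n⇒∣m+n (d∣b reflection) d∣e))
    where
    d∣e : d ∣ e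
    d∣e = ∣m+n∣m⇒∣n d∣c+e d∣c
    d∣2c : d ∣ 2 * c
    d∣2c = ∣n⇒∣m*n 2 d∣c
    d∣b : b + t ≡ 2 * c ⊎ 2 * c + t ≡ b → d ∣ b
    d∣b (inj₁ b+t≡2c) = ∣m+n∣m⇒∣n (subst (d ∣_) (trans (sym b+t≡2c) (+-comm b t)) d∣2c) d∣t
    d∣b (inj₂ 2c+t≡b) = subst (d ∣_) 2c+t≡b (∣m∣n⇒∣m+n d∣2c d∣t)

suitable-⊓ : ∀ {N X b e c} → 0 < X → 0 < c → X ≡ b + e → b ≤ 3 * c →
             b * b + N ≡ 4 * X * c → Coprime c X → Suitable (- (+ N)) (X ⊓ c)
suitable-⊓ {X = X} {b} {e} {c} 0<X 0<c X≡b+e b≤3c disc c⊥X with X ≤? c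
... | yes X≤c rewrite m≤n⇒m⊓n≡m X≤c =
  0<X , + b , + c , inT 0<X b≤X X≤c disc (λ d∣X _ d∣c → c⊥X (d∣c , d∣X))
  where
  b≤X : b ≤ X
  b≤X = subst (b ≤_) (sym X≡b+e) (m≤m+n b e)
... | no X≰c with c<X ← ≰⇒> X≰c rewrite m≥n⇒m⊓n≡n (<⇒≤ c<X) with b ≤? c
...   | yes b≤c = 0<c , + b , + X , inT 0<c b≤c (<⇒≤ c<X) (trans disc (solve (X ∷ c ∷ [])))
                                          (λ d∣c _ d∣X → c⊥X (d∣c , d∣X))
...   | no b≰c with t , t≤c , reflection ← ∣b-2c∣≤c (<⇒≤ (≰⇒> b≰c)) b≤3c =
  0<c , + t , + (c + e) , inT-reduced 0<c t≤c X≡b+e disc c⊥X reflection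

suitable-square⊓ : ∀ {x q δ m c} → 0 < x → x ≡ q + δ → 4 * c ≡ q * q + m →
                   4 * (x * x) ≤ 9 * m → Coprime c x → Suitable (- (+ (x * x * m))) (x * x ⊓ c)
suitable-square⊓ {x} {q} {δ} {m} {c} 0<x x≡q+δ 4c≡q*q+m 4x²≤9m c⊥x =
  suitable-⊓ 0<x² 0<c (trans (cong (x *_) x≡q+δ) (*-distribˡ-+ x q δ)) xq≤3c disc
    (coprime-*ʳ c⊥x c⊥x)
  where
  0<x² : 0 < x * x
  0<x² = *-mono-< 0<x 0<x
  0<m : 0 < m
  0<m = *-cancelˡ-< 9 0 m (<-≤-trans (*-monoʳ-< 4 0<x²) 4x²≤9m)
  0<c : 0 < c
  0<c = *-cancelˡ-< 4 0 c (<-≤-trans 0<m (subst (m ≤_) (sym 4c≡q*q+m) (m≤n+m m (q * q))))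
  xq≤3c : x * q ≤ 3 * c
  xq≤3c = *-cancelˡ-≤ 12 (begin
    12 * (x * q)                       ≡⟨ solve (x ∷ q ∷ []) ⟩
    2 * (2 * x) * (3 * q)              ≤⟨ 2*m*n≤m*m+n*n (2 * x) (3 * q) ⟩
    2 * x * (2 * x) + 3 * q * (3 * q)  ≡⟨ solve (x ∷ q ∷ []) ⟩
    4 * (x * x) + 9 * (q * q)          ≤⟨ +-monoˡ-≤ (9 * (q * q)) 4x²≤9m ⟩
    9 * m + 9 * (q * q)                ≡⟨ solve (m ∷ q ∷ []) ⟩
    9 * (q * q + m)                    ≡⟨ cong (9 *_) 4c≡q*q+m ⟨
    9 * (4 * c)                        ≡⟨ solve (c ∷ []) ⟩
    12 * (3 * c)                       ∎)
    where open ≤-Reasoning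
  disc : x * q * (x * q) + x * x * m ≡ 4 * (x * x) * c
  disc = begin
    x * q * (x * q) + x * x * m  ≡⟨ solve (x ∷ q ∷ m ∷ []) ⟩
    x * x * (q * q + m)          ≡⟨ cong (x * x *_) 4c≡q*q+m ⟨
    x * x * (4 * c)              ≡⟨ solve (x ∷ c ∷ []) ⟩
    4 * (x * x) * c              ∎
    where open ≡-Reasoning

4*[m+q^2]/4≡q*q+m : ∀ {x q m} → x % 2 ≡ 1 → x ≡ q + (1 + m % 2) → m % 4 ≡ 0 ⊎ m % 4 ≡ 3 →
                    4 * ((m + q ^ 2) / 4) ≡ q * q + m
4*[m+q^2]/4≡q*q+m {x} {q} {m} x%2≡1 x≡q+δ m%4 =
  trans (m*[n/m]≡n (subst (4 ∣_) q*q+m≡m+q^2 4∣q*q+m)) (sym q*q+m≡m+q^2)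
  where
  open ≡-Reasoning
  q*q+m≡m+q^2 : q * q + m ≡ m + q ^ 2
  q*q+m≡m+q^2 = trans (+-comm (q * q) m) (cong (λ n → m + q * n) (sym (^-identityʳ q)))
  q%2≡m%2 : q % 2 ≡ m % 2
  q%2≡m%2 = trans ([m+n]%2≡1⇒m%2≡[1+n]%2 q (1 + m % 2) (subst (λ n → n % 2 ≡ 1) x≡q+δ x%2≡1))
                  (m%n%n≡m%n m 2)
  residue : ∀ {r} → r ≡ 0 ⊎ r ≡ 3 → (r % 2 + r) % 4 ≡ 0
  residue (inj₁ refl) = refl
  residue (inj₂ refl) = refl
  4∣q*q+m : 4 ∣ q * q + m
  4∣q*q+m = m%n≡0⇒n∣m (q * q + m) 4 (begin
    (q * q + m) % 4          ≡⟨ %-distribˡ-+ (q * q) m 4 ⟩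
    (q * q % 4 + m % 4) % 4  ≡⟨ cong (λ r → (r + m % 4) % 4) (trans (n*n%4≡n%2 q) q%2≡m%2) ⟩
    (m % 2 + m % 4) % 4      ≡⟨ cong (λ r → (r + m % 4) % 4) (m∣n⇒o%n%m≡o%m 2 4 m (divides-refl 2)) ⟨
    (m % 4 % 2 + m % 4) % 4  ≡⟨ residue m%4 ⟩
    0                        ∎)

prime∤[q*q+m]/4 : ∀ {p q δ m c} → Prime p → p ∣ m → p ∣ q + δ → ¬ p ∣ δ → 4 * c ≡ q * q + m → ¬ p ∣ c
prime∤[q*q+m]/4 {p} {q} {m = m} p-prime p∣m p∣q+δ p∤δ 4c≡q*q+m p∣c = p∤δ (∣m+n∣m⇒∣n p∣q+δ p∣q)
  where
  p∣q*q : p ∣ q * q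
  p∣q*q = ∣m+n∣m⇒∣n (subst (p ∣_) (trans 4c≡q*q+m (+-comm (q * q) m)) (∣n⇒∣m*n 4 p∣c)) p∣m
  p∣q : p ∣ q
  p∣q = [ id , id ]′ (euclidsLemma q q p-prime p∣q*q)

suitable-power : ∀ {p m} k → Prime p → p % 2 ≡ 1 → p ∣ m → m % 4 ≡ 0 ⊎ m % 4 ≡ 3 →
  4 * (p ^ suc k * p ^ suc k) ≤ 9 * m →
  Suitable (- (+ (p ^ suc k * p ^ suc k * m)))
           (p ^ suc k * p ^ suc k ⊓ ((m + (p ^ suc k ∸ (1 + m % 2)) ^ 2) / 4))
suitable-power {p} {m} k p-prime p%2≡1 p∣m m%4 4x²≤9m =
  suitable-square⊓ {q = q} {δ} (m^n>0 p (suc k)) x≡q+δ 4c≡q*q+m 4x²≤9m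
    (coprime-^ʳ (∤-prime⇒coprime p-prime p∤c) (suc k))
  where
  instance
    p≢0 : NonZero p
    p≢0 = prime⇒nonZero p-prime
  x = p ^ suc k
  δ = 1 + m % 2
  q = x ∸ δ
  δ<p : δ < p
  δ<p = ≤-<-trans (m%n<n m 2) (1<n∧n%2≡1⇒2<n (nonTrivial⇒n>1 p {{prime⇒nonTrivial p-prime}}) p%2≡1)
  x≡q+δ : x ≡ q + δ
  x≡q+δ = sym (m∸n+n≡m (<⇒≤ (<-≤-trans δ<p (m≤m*n p (p ^ k) {{m^n≢0 p k}}))))
  4c≡q*q+m : 4 * ((m + q ^ 2) / 4) ≡ q * q + m
  4c≡q*q+m = 4*[m+q^2]/4≡q*q+m (m%2≡1⇒m^n%2≡1 p (suc k) p%2≡1) x≡q+δ m%4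
  p∤c : ¬ p ∣ (m + q ^ 2) / 4
  p∤c = prime∤[q*q+m]/4 p-prime p∣m (subst (p ∣_) x≡q+δ (m∣m*n (p ^ k))) (>⇒∤ δ<p) 4c≡q*q+m

proposition3p3 : (Δ : ℤ) → ImagQuadDisc Δ →
    (p : ℕ) → Prime p → p % 2 ≡ 1 →
    (k : ℕ) → 1 ≤ k →
    p ^ (2 * k + 1) ∣ ∣ Δ ∣ →
    (m : ℕ) → Δ ≡ - (+ (p ^ (2 * k) * m)) →
    4 * p ^ (2 * k) ≤ 9 * m →
    Suitable Δ (p ^ (2 * k) ⊓ ((m + (p ^ k ∸ deltaOf Δ) ^ 2) / 4))
proposition3p3 _ Δ-disc p p-prime p%2≡1 k@(suc k-1) _ p^[2k+1]∣∣Δ∣ m refl 4p^[2k]≤9m =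
  subst₂ (λ u δ → Suitable (- (+ (u * m))) (u ⊓ ((m + (p ^ k ∸ δ) ^ 2) / 4)))
    (m^n*m^n≡m^[2*n] p k) (sym δ≡1+m%2)
    (suitable-power k-1 p-prime p%2≡1 p∣m m%4
      (subst (λ u → 4 * u ≤ 9 * m) (sym (m^n*m^n≡m^[2*n] p k)) 4p^[2k]≤9m))
  where
  instance
    p≢0 : NonZero p
    p≢0 = prime⇒nonZero p-prime
  δ≡1+m%2 : deltaOf (- (+ (p ^ (2 * k) * m))) ≡ 1 + m % 2
  δ≡1+m%2 = trans (deltaOf-neg (p ^ (2 * k) * m))
              (cong suc (m%d≡1⇒m*n%d≡n%d (p ^ (2 * k)) m (m%2≡1⇒m^n%2≡1 p (2 * k) p%2≡1)))
  p^[2k]%4≡1 : p ^ (2 * k) % 4 ≡ 1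
  p^[2k]%4≡1 = subst (λ n → n % 4 ≡ 1) (m^n*m^n≡m^[2*n] p k)
                 (trans (n*n%4≡n%2 (p ^ k)) (m%2≡1⇒m^n%2≡1 p k p%2≡1))
  m%4 : m % 4 ≡ 0 ⊎ m % 4 ≡ 3
  m%4 = subst (λ r → r ≡ 0 ⊎ r ≡ 3) (m%d≡1⇒m*n%d≡n%d (p ^ (2 * k)) m p^[2k]%4≡1)
          (imagQuadDisc⇒%4 (p ^ (2 * k) * m) Δ-disc)
  p∣m : p ∣ m
  p∣m = m^[n+1]∣m^n*o⇒m∣o p (2 * k) m
          (subst (p ^ (2 * k + 1) ∣_) (ℤP.∣-i∣≡∣i∣ (+ (p ^ (2 * k) * m))) p^[2k+1]∣∣Δ∣)
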